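{- Let $k\ge 2$, let $p$ be a prime, and let $J\subseteq\{1,2,\dots,k-1\}$ with $J\neq\varnothing$. Then \[ N_k(J\cup\{k\},p)=\sum_{j=1}^k(-1)^{j+1}\binom{k}{j}\,N_{k-j}\big(J\setminus\{k-j+1,\dots,k-1\},p\big). \]
   Context: For integers $m\ge 0$ and a set $I\subseteq\{1,\dots,m\}$, $N_m(I,p)$ denotes the number of $(a_1,\dots,a_m)\in\mathbb{F}_p^m$ such that $e_i(a_1,\dots,a_m)\equiv 0\pmod p$ for every $i\in I$, where $e_i(x_1,\dots,x_m)=\sum_{1\le l_1<\dots<l_i\le m}x_{l_1}\cdots x_{l_i}$ is the $i$-th elementary symmetric polynomial. (Thus $N_m(\varnothing,p)=p^m$, and in particular $N_0(\varnothing,p)=1$.) For $j=1$ the set $\{k-j+1,\dots,k-1\}$ is empty. -}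

module Defs where

open import Data.Nat using (ℕ; zero; suc; _+_; _*_)
open import Data.Nat.Divisibility using (_∣?_)
open import Data.List using (List; []; _∷_; map; concatMap; upTo; length; filter)
open import Data.List.Relation.Unary.All using (All; all?)
open import Data.Integer as ℤ using (ℤ)

-- Elementary symmetric polynomial e_i evaluated at a list of naturals
-- (computed over ℕ; reduction mod p is handled by divisibility).
-- e₀ = 1, e_{i}([]) = 0 for i ≥ 1, e_{i+1}(x ∷ xs) = x·e_i(xs) + e_{i+1}(xs).
esym : ℕ → List ℕ → ℕ
esym zero    _        = 1
esym (suc i) []       = 0
esym (suc i) (x ∷ xs) = x * esym i xs + esym (suc i) xs

-- All tuples of length m with entries in {0,…,p-1} (i.e. 𝔽_p^m via representatives).
tuples : ℕ → ℕ → List (List ℕ)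
tuples p zero    = [] ∷ []
tuples p (suc m) = concatMap (λ a → map (a ∷_) (tuples p m)) (upTo p)

N : ℕ → List ℕ → ℕ → ℕ
N m I p = length (filter (λ a → all? (λ i → p ∣? esym i a) I) (tuples p m))

sumℤ : List ℤ → ℤ
sumℤ []       = ℤ.0ℤ
sumℤ (x ∷ xs) = x ℤ.+ sumℤ xs

module Submission where

open import Defs
open import Data.Nat using (ℕ; suc; _≤_; _<_; _∸_; _≤?_)
open import Data.Nat.Primality using (Prime)
open import Data.Nat.Combinatorics using (_C_)
open import Data.List using (List; []; _∷_; filter; map; upTo)
open import Data.List.Relation.Unary.All using (All)
open import Data.Integer as ℤ using (ℤ; +_)
open import Data.Product using (_×_)
open import Relation.Binary.PropositionalEquality using (_≡_; _≢_)

open import Data.Bool using (Bool; true; false; _∧_)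
open import Data.Fin using (Fin; zero; suc; toℕ; inject₁; fromℕ)
open import Data.Fin.Properties using (toℕ<n; toℕ-inject₁; toℕ-fromℕ)
open import Data.Integer using (0ℤ; 1ℤ; -1ℤ; _+_; _-_; _*_; _^_)
import Data.Integer.Properties as ℤP
open import Data.Integer.Tactic.RingSolver using (solve-∀)
open import Algebra.Properties.Semiring.Sum ℤP.+-*-semiring
  using (sum-syntax; sum⁺-syntax; sum-cong-≗; ∑-distrib-+; ∑-comm; *-distribˡ-sum; sum-init-last)
open import Data.List using (_++_; applyUpTo; concatMap; length)
open import Data.List.Properties
  using (filter-++; filter-accept; filter-reject; length-++; map-upTo)
open import Data.List.Relation.Unary.All using (all?)
import Data.Nat as ℕ
open import Data.Nat using (zero; s≤s)
import Data.Nat.Properties as ℕP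
open import Data.Nat.Combinatorics using (nCk+nC[k+1]≡[n+1]C[k+1]; k>n⇒nCk≡0)
open import Data.Nat.Divisibility using (_∣_; _∣?_; _∣0; ∣1⇒≡1; ∣⇒≤; ∣n⇒∣m*n)
open import Data.Nat.ListAction using (product)
open import Data.Nat.Primality using (¬prime[0]; ¬prime[1]; euclidsLemma)
open import Data.Sum using (inj₁; inj₂)
open import Function using (_∘_; id; mk⇔)
open import Relation.Binary.PropositionalEquality
  using (refl; sym; trans; cong; cong₂; subst; module ≡-Reasoning)
open import Relation.Nullary using (does; yes; no; contradiction)
open import Relation.Nullary.Decidable using (dec-true; dec-false; does-⇔)
open import Relation.Unary using (Decidable)

open ≡-Reasoning

-- Since p is prime, e_k(a) = a₁⋯a_k vanishes mod p iff some aᵢ is 0, so N_k(J ∪ {k}) = f(k) − g(k),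
-- where f(r) and g(r) count the length-r solutions of the J-conditions, resp. those with no zero
-- entry. As eᵢ vanishes on tuples shorter than i, f(r) = N_r(J ∖ {r+1, …}). Deleting a zero entry
-- changes no eᵢ, so inclusion–exclusion over the zero positions gives g(k) = Σⱼ (−1)ʲ C(k,j) f(k−j),
-- i.e. g(k) = (Δᵏ f)(0). This holds for any condition invariant under inserting zeros, by induction
-- on k: splitting off the first entry shows that (Δ f)(r) is the sum, over the nonzero values a of
-- that entry, of f for the condition with a prepended.

∑-distrib-sub : ∀ {n} (f g : Fin n → ℤ) →
                ∑[ i < n ] (f i - g i) ≡ ∑[ i < n ] f i - ∑[ i < n ] g i
∑-distrib-sub {zero}  f g = refl
∑-distrib-sub {suc n} f g =
  trans (cong (_+_ (f zero - g zero)) (∑-distrib-sub (f ∘ suc) (g ∘ suc)))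
        (interchange (f zero) (g zero) (∑[ i < n ] f (suc i)) (∑[ i < n ] g (suc i)))
  where
  interchange : ∀ a b c d → a - b + (c - d) ≡ a + c - (b + d)
  interchange = solve-∀

Δ : (ℕ → ℤ) → ℕ → ℤ
Δ f r = f (suc r) - f r

signedBinomial : ℕ → ℕ → ℤ
signedBinomial m j = -1ℤ ^ j * + (m C j)

iteratedDifference : ℕ → (ℕ → ℤ) → ℤ
iteratedDifference m f = ∑[ j ≤ m ] (signedBinomial m (toℕ j) * f (m ∸ toℕ j))

iteratedDifference-cong : ∀ m {f g : ℕ → ℤ} → (∀ r → f r ≡ g r) →
                          iteratedDifference m f ≡ iteratedDifference m g
iteratedDifference-cong m f≗g =
  sum-cong-≗ {suc m} (λ j → cong (_*_ (signedBinomial m (toℕ j))) (f≗g (m ∸ toℕ j)))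

iteratedDifference-∑ : ∀ m {n} (g : Fin n → ℕ → ℤ) →
  iteratedDifference m (λ r → ∑[ a < n ] g a r) ≡ ∑[ a < n ] iteratedDifference m (g a)
iteratedDifference-∑ m {n} g = begin
    ∑[ j ≤ m ] (c j * ∑[ a < n ] g a (m ∸ toℕ j))
  ≡⟨ sum-cong-≗ {suc m} (λ j → *-distribˡ-sum (c j) (λ a → g a (m ∸ toℕ j))) ⟩
    ∑[ j ≤ m ] ∑[ a < n ] (c j * g a (m ∸ toℕ j))
  ≡⟨ ∑-comm (λ j a → c j * g a (m ∸ toℕ j)) ⟩
    ∑[ a < n ] iteratedDifference m (g a)
  ∎
  where
  c : Fin (suc m) → ℤ
  c j = signedBinomial m (toℕ j)

iteratedDifference-sub : ∀ m (f g : ℕ → ℤ) →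
  iteratedDifference m (λ r → f r - g r) ≡ iteratedDifference m f - iteratedDifference m g
iteratedDifference-sub m f g =
  trans (sum-cong-≗ {suc m} (λ j → distrib (c j) (f (m ∸ toℕ j)) (g (m ∸ toℕ j))))
        (∑-distrib-sub (λ j → c j * f (m ∸ toℕ j)) (λ j → c j * g (m ∸ toℕ j)))
  where
  c : Fin (suc m) → ℤ
  c j = signedBinomial m (toℕ j)
  distrib : ∀ c x y → c * (x - y) ≡ c * x - c * y
  distrib = solve-∀

iteratedDifference-∘suc : ∀ m (f : ℕ → ℤ) → iteratedDifference m (f ∘ suc) ≡
  f (suc m) + ∑[ j ≤ m ] (signedBinomial m (suc (toℕ j)) * f (m ∸ toℕ j))
iteratedDifference-∘suc m f = begin
    1ℤ * + 1 * f (suc m) + ∑[ i < m ] shifted (suc i)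
  ≡⟨ cong₂ _+_ (ℤP.*-identityˡ (f (suc m))) (sum-cong-≗ {m} reindex) ⟩
    f (suc m) + ∑[ i < m ] term (inject₁ i)
  ≡⟨ cong (_+_ (f (suc m))) (sym (ℤP.+-identityʳ (∑[ i < m ] term (inject₁ i)))) ⟩
    f (suc m) + (∑[ i < m ] term (inject₁ i) + 0ℤ)
  ≡⟨ cong (λ t → f (suc m) + (∑[ i < m ] term (inject₁ i) + t)) (sym lastTerm≡0) ⟩
    f (suc m) + (∑[ i < m ] term (inject₁ i) + term (fromℕ m))
  ≡⟨ cong (_+_ (f (suc m))) (sym (sum-init-last term)) ⟩
    f (suc m) + ∑[ j ≤ m ] term j
  ∎
  where
  shifted term : Fin (suc m) → ℤ
  shifted j = signedBinomial m (toℕ j) * f (suc (m ∸ toℕ j))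
  term j = signedBinomial m (suc (toℕ j)) * f (m ∸ toℕ j)
  reindex : ∀ i → shifted (suc i) ≡ term (inject₁ i)
  reindex i = begin
      signedBinomial m (suc (toℕ i)) * f (suc (m ∸ suc (toℕ i)))
    ≡⟨ cong (λ r → signedBinomial m (suc (toℕ i)) * f r) (sym (ℕP.+-∸-assoc 1 (toℕ<n i))) ⟩
      signedBinomial m (suc (toℕ i)) * f (m ∸ toℕ i)
    ≡⟨ cong (λ j → signedBinomial m (suc j) * f (m ∸ j)) (sym (toℕ-inject₁ i)) ⟩
      term (inject₁ i)
    ∎
  lastTerm≡0 : term (fromℕ m) ≡ 0ℤ
  lastTerm≡0 rewrite toℕ-fromℕ m | k>n⇒nCk≡0 (ℕP.n<1+n m) =
    trans (cong (_* f (m ∸ m)) (ℤP.*-zeroʳ (-1ℤ ^ suc m))) (ℤP.*-zeroˡ (f (m ∸ m)))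

iteratedDifference-suc : ∀ m (f : ℕ → ℤ) →
                         iteratedDifference (suc m) f ≡ iteratedDifference m (Δ f)
iteratedDifference-suc m f = begin
    first + ∑[ j ≤ m ] (signedBinomial (suc m) (suc (toℕ j)) * f (m ∸ toℕ j))
  ≡⟨ cong (_+_ first) (sum-cong-≗ {suc m} (λ j → pascal (toℕ j))) ⟩
    first + ∑[ j ≤ m ] (term (toℕ j) - previous (toℕ j))
  ≡⟨ cong (_+_ first) (∑-distrib-sub {suc m} (term ∘ toℕ) (previous ∘ toℕ)) ⟩
    first + (∑[ j ≤ m ] term (toℕ j) - iteratedDifference m f)
  ≡⟨ regroup (f (suc m)) (∑[ j ≤ m ] term (toℕ j)) (iteratedDifference m f) ⟩
    f (suc m) + ∑[ j ≤ m ] term (toℕ j) - iteratedDifference m f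
  ≡⟨ cong (_- iteratedDifference m f) (sym (iteratedDifference-∘suc m f)) ⟩
    iteratedDifference m (f ∘ suc) - iteratedDifference m f
  ≡⟨ sym (iteratedDifference-sub m (f ∘ suc) f) ⟩
    iteratedDifference m (Δ f)
  ∎
  where
  first : ℤ
  first = 1ℤ * + 1 * f (suc m)
  term previous : ℕ → ℤ
  term j = signedBinomial m (suc j) * f (m ∸ j)
  previous j = signedBinomial m j * f (m ∸ j)
  expand : ∀ s a b x → -1ℤ * s * (a + b) * x ≡ -1ℤ * s * b * x - s * a * x
  expand = solve-∀
  pascal : ∀ j → signedBinomial (suc m) (suc j) * f (m ∸ j) ≡ term j - previous j
  pascal j = begin
      -1ℤ ^ suc j * + (suc m C suc j) * f (m ∸ j)
    ≡⟨ cong (λ c → -1ℤ ^ suc j * c * f (m ∸ j))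
            (trans (cong +_ (sym (nCk+nC[k+1]≡[n+1]C[k+1] m j))) (ℤP.pos-+ (m C j) (m C suc j))) ⟩
      -1ℤ * -1ℤ ^ j * (+ (m C j) + + (m C suc j)) * f (m ∸ j)
    ≡⟨ expand (-1ℤ ^ j) (+ (m C j)) (+ (m C suc j)) (f (m ∸ j)) ⟩
      term j - previous j
    ∎
  regroup : ∀ x a b → 1ℤ * + 1 * x + (a - b) ≡ x + a - b
  regroup = solve-∀

last-minus-iteratedDifference : ∀ m (f : ℕ → ℤ) → f m - iteratedDifference m f ≡
  ∑[ i < m ] (-1ℤ ^ suc (suc (toℕ i)) * + (m C suc (toℕ i)) * f (m ∸ suc (toℕ i)))
last-minus-iteratedDifference m f = begin
    f m - (1ℤ * + 1 * f m + ∑[ i < m ] term i)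
  ≡⟨ cancel (f m) (∑[ i < m ] term i) ⟩
    -1ℤ * ∑[ i < m ] term i
  ≡⟨ *-distribˡ-sum -1ℤ term ⟩
    ∑[ i < m ] (-1ℤ * term i)
  ≡⟨ sum-cong-≗ {m} (λ i → reassociate (-1ℤ ^ suc (toℕ i)) (+ (m C suc (toℕ i)))
                                        (f (m ∸ suc (toℕ i)))) ⟩
    ∑[ i < m ] (-1ℤ ^ suc (suc (toℕ i)) * + (m C suc (toℕ i)) * f (m ∸ suc (toℕ i)))
  ∎
  where
  term : Fin m → ℤ
  term i = signedBinomial m (suc (toℕ i)) * f (m ∸ suc (toℕ i))
  cancel : ∀ x s → x - (1ℤ * + 1 * x + s) ≡ -1ℤ * s
  cancel = solve-∀
  reassociate : ∀ s c x → -1ℤ * (s * c * x) ≡ -1ℤ * s * c * x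
  reassociate = solve-∀

length-filter-map : ∀ {A B : Set} {P : B → Set} (P? : Decidable P) (f : A → B) xs →
                    length (filter P? (map f xs)) ≡ length (filter (P? ∘ f) xs)
length-filter-map P? f []       = refl
length-filter-map P? f (x ∷ xs) with does (P? (f x))
... | true  = cong suc (length-filter-map P? f xs)
... | false = length-filter-map P? f xs

length-filter-concatMap : ∀ {A : Set} {P : A → Set} (P? : Decidable P) (G : ℕ → List A) h k →
  + length (filter P? (concatMap G (applyUpTo h k))) ≡
  ∑[ i < k ] (+ length (filter P? (G (h (toℕ i)))))
length-filter-concatMap P? G h zero    = refl
length-filter-concatMap P? G h (suc k) = begin
    + length (filter P? (G (h 0) ++ rest))
  ≡⟨ cong (+_ ∘ length) (filter-++ P? (G (h 0)) rest) ⟩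
    + length (filter P? (G (h 0)) ++ filter P? rest)
  ≡⟨ cong +_ (length-++ (filter P? (G (h 0)))) ⟩
    + (length (filter P? (G (h 0))) ℕ.+ length (filter P? rest))
  ≡⟨ ℤP.pos-+ (length (filter P? (G (h 0)))) (length (filter P? rest)) ⟩
    + length (filter P? (G (h 0))) + + length (filter P? rest)
  ≡⟨ cong (_+_ (+ length (filter P? (G (h 0))))) (length-filter-concatMap P? G (h ∘ suc) k) ⟩
    ∑[ i < suc k ] (+ length (filter P? (G (h (toℕ i)))))
  ∎
  where
  rest : List _
  rest = concatMap G (applyUpTo (h ∘ suc) k)

sumℤ-applyUpTo : ∀ (g : ℕ → ℤ) h k → sumℤ (map g (applyUpTo h k)) ≡ ∑[ i < k ] g (h (toℕ i))
sumℤ-applyUpTo g h zero    = refl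
sumℤ-applyUpTo g h (suc k) = cong (_+_ (g (h 0))) (sumℤ-applyUpTo g (h ∘ suc) k)

esym-insert0 : ∀ i ys xs → esym i (ys ++ 0 ∷ xs) ≡ esym i (ys ++ xs)
esym-insert0 zero    ys       xs = refl
esym-insert0 (suc i) []       xs = refl
esym-insert0 (suc i) (y ∷ ys) xs =
  cong₂ (λ a b → y ℕ.* a ℕ.+ b) (esym-insert0 i ys xs) (esym-insert0 (suc i) ys xs)

length<i⇒esym≡0 : ∀ {i} xs → length xs < i → esym i xs ≡ 0
length<i⇒esym≡0 {suc i}       []       _           = refl
length<i⇒esym≡0 {suc (suc i)} (x ∷ xs) (s≤s len<i)
  rewrite length<i⇒esym≡0 xs len<i | length<i⇒esym≡0 xs (ℕP.m<n⇒m<1+n len<i) =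
  trans (ℕP.+-identityʳ (x ℕ.* 0)) (ℕP.*-zeroʳ x)

esym[length]≡product : ∀ xs → esym (length xs) xs ≡ product xs
esym[length]≡product []       = refl
esym[length]≡product (x ∷ xs) =
  trans (cong₂ (λ a b → x ℕ.* a ℕ.+ b)
               (esym[length]≡product xs) (length<i⇒esym≡0 xs ℕP.≤-refl))
        (ℕP.+-identityʳ (x ℕ.* product xs))

esymsVanish : ℕ → List ℕ → List ℕ → Bool
esymsVanish p I xs = does (all? (λ i → p ∣? esym i xs) I)

ZeroInsertionInvariant : (List ℕ → Bool) → Set
ZeroInsertionInvariant q = ∀ ys xs → q (ys ++ 0 ∷ xs) ≡ q (ys ++ xs)

esymsVanish-cong : ∀ p I {xs ys} → (∀ i → esym i xs ≡ esym i ys) →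
                   esymsVanish p I xs ≡ esymsVanish p I ys
esymsVanish-cong p []      eq = refl
esymsVanish-cong p (i ∷ I) eq =
  cong₂ _∧_ (cong (λ e → does (p ∣? e)) (eq i)) (esymsVanish-cong p I eq)

esymsVanish-zeroInsertionInvariant : ∀ p I → ZeroInsertionInvariant (esymsVanish p I)
esymsVanish-zeroInsertionInvariant p I ys xs = esymsVanish-cong p I (λ i → esym-insert0 i ys xs)

esymsVanish-filter : ∀ p I {r xs} → length xs ≡ r →
                     esymsVanish p (filter (_≤? r) I) xs ≡ esymsVanish p I xs
esymsVanish-filter p []      len≡r = refl
esymsVanish-filter p (i ∷ I) {r} {xs} len≡r with i ≤? r
... | yes i≤r rewrite filter-accept (_≤? r) {xs = I} i≤r =
  cong (_∧_ (does (p ∣? esym i xs))) (esymsVanish-filter p I len≡r)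
... | no  i≰r rewrite filter-reject (_≤? r) {xs = I} i≰r =
  trans (esymsVanish-filter p I len≡r)
        (cong (_∧ esymsVanish p I xs) (sym (dec-true (p ∣? esym i xs) p∣esym)))
  where
  p∣esym : p ∣ esym i xs
  p∣esym = subst (p ∣_) (sym (length<i⇒esym≡0 xs (subst (_< i) (sym len≡r) (ℕP.≰⇒> i≰r))))
                 (p ∣0)

indicator : Bool → ℤ
indicator true  = 1ℤ
indicator false = 0ℤ

-- Tuples over the alphabet {0, …, n}; its nonzero letters are the suc (toℕ a) with a : Fin n.
module Tuples (n : ℕ) where

  count : (List ℕ → Bool) → ℕ → ℤ
  count q zero    = indicator (q [])
  count q (suc m) = ∑[ a < suc n ] count (λ xs → q (toℕ a ∷ xs)) m

  countNonzero : (List ℕ → Bool) → ℕ → ℤ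
  countNonzero q zero    = indicator (q [])
  countNonzero q (suc m) = ∑[ a < n ] countNonzero (λ xs → q (suc (toℕ a) ∷ xs)) m

  count-cong : ∀ m {q q′ : List ℕ → Bool} → (∀ xs → length xs ≡ m → q xs ≡ q′ xs) →
               count q m ≡ count q′ m
  count-cong zero    q≗q′ = cong indicator (q≗q′ [] refl)
  count-cong (suc m) q≗q′ =
    sum-cong-≗ {suc n} (λ a → count-cong m (λ xs len≡m → q≗q′ (toℕ a ∷ xs) (cong suc len≡m)))

  length-filter-tuples : ∀ {P : List ℕ → Set} (P? : Decidable P) m →
    + length (filter P? (tuples (suc n) m)) ≡ count (λ xs → does (P? xs)) m
  length-filter-tuples P? zero with does (P? [])
  ... | true  = refl
  ... | false = refl
  length-filter-tuples P? (suc m) =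
    trans (length-filter-concatMap P? (λ a → map (a ∷_) (tuples (suc n) m)) id (suc n))
          (sum-cong-≗ {suc n} (λ a →
             trans (cong +_ (length-filter-map P? (toℕ a ∷_) (tuples (suc n) m)))
                   (length-filter-tuples (P? ∘ (toℕ a ∷_)) m)))

  N≡count : ∀ m I → + N m I (suc n) ≡ count (esymsVanish (suc n) I) m
  N≡count m I = length-filter-tuples (λ xs → all? (λ i → suc n ∣? esym i xs) I) m

  N[filter]≡count : ∀ r J → + N r (filter (_≤? r) J) (suc n) ≡ count (esymsVanish (suc n) J) r
  N[filter]≡count r J =
    trans (N≡count r (filter (_≤? r) J)) (count-cong r (λ xs → esymsVanish-filter (suc n) J))

  Δ-count : ∀ {q} → ZeroInsertionInvariant q → ∀ r →
            Δ (count q) r ≡ ∑[ a < n ] count (λ xs → q (suc (toℕ a) ∷ xs)) r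
  Δ-count {q} invariant r = begin
      count (λ xs → q (0 ∷ xs)) r + nonzero - count q r
    ≡⟨ cong (λ c → c + nonzero - count q r) (count-cong r (λ xs _ → invariant [] xs)) ⟩
      count q r + nonzero - count q r
    ≡⟨ cancel (count q r) nonzero ⟩
      nonzero
    ∎
    where
    nonzero : ℤ
    nonzero = ∑[ a < n ] count (λ xs → q (suc (toℕ a) ∷ xs)) r
    cancel : ∀ x s → x + s - x ≡ s
    cancel = solve-∀

  countNonzero≡iteratedDifference : ∀ m {q} → ZeroInsertionInvariant q →
                                    countNonzero q m ≡ iteratedDifference m (count q)
  countNonzero≡iteratedDifference zero {q} _ = sym (unit (indicator (q [])))
    where
    unit : ∀ x → 1ℤ * + 1 * x + 0ℤ ≡ x
    unit = solve-∀
  countNonzero≡iteratedDifference (suc m) {q} invariant = begin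
      ∑[ a < n ] countNonzero (qₐ a) m
    ≡⟨ sum-cong-≗ {n} (λ a → countNonzero≡iteratedDifference m (invariant ∘ (suc (toℕ a) ∷_))) ⟩
      ∑[ a < n ] iteratedDifference m (count (qₐ a))
    ≡⟨ sym (iteratedDifference-∑ m (λ a → count (qₐ a))) ⟩
      iteratedDifference m (λ r → ∑[ a < n ] count (qₐ a) r)
    ≡⟨ sym (iteratedDifference-cong m (Δ-count invariant)) ⟩
      iteratedDifference m (Δ (count q))
    ≡⟨ sym (iteratedDifference-suc m (count q)) ⟩
      iteratedDifference (suc m) (count q)
    ∎
    where
    qₐ : Fin n → List ℕ → Bool
    qₐ a xs = q (suc (toℕ a) ∷ xs)

  module _ (z : List ℕ → Bool) (z[]≡false : z [] ≡ false)
           (z[0∷xs]≡true : ∀ xs → z (0 ∷ xs) ≡ true)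
           (z-nonzero∷ : ∀ (a : Fin n) xs → z (suc (toℕ a) ∷ xs) ≡ z xs) where

    count-partition : ∀ m q → count q m ≡ count (λ xs → z xs ∧ q xs) m + countNonzero q m
    count-partition zero q rewrite z[]≡false = sym (ℤP.+-identityˡ (indicator (q [])))
    count-partition (suc m) q = begin
        count q₀ m + ∑[ a < n ] count (qₐ a) m
      ≡⟨ cong (_+_ (count q₀ m)) (sum-cong-≗ {n} (λ a → count-partition m (qₐ a))) ⟩
        count q₀ m + ∑[ a < n ] (count (z∧ (qₐ a)) m + countNonzero (qₐ a) m)
      ≡⟨ cong (_+_ (count q₀ m))
              (∑-distrib-+ (λ a → count (z∧ (qₐ a)) m) (λ a → countNonzero (qₐ a) m)) ⟩
        count q₀ m + (∑[ a < n ] count (z∧ (qₐ a)) m + countNonzero q (suc m))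
      ≡⟨ sym (ℤP.+-assoc (count q₀ m) _ _) ⟩
        count q₀ m + ∑[ a < n ] count (z∧ (qₐ a)) m + countNonzero q (suc m)
      ≡⟨ cong₂ (λ u v → u + v + countNonzero q (suc m)) zeroFirst nonzeroFirst ⟩
        count (z∧ q) (suc m) + countNonzero q (suc m)
      ∎
      where
      q₀ : List ℕ → Bool
      q₀ xs = q (0 ∷ xs)
      qₐ : Fin n → List ℕ → Bool
      qₐ a xs = q (suc (toℕ a) ∷ xs)
      z∧ : (List ℕ → Bool) → List ℕ → Bool
      z∧ q′ xs = z xs ∧ q′ xs
      zeroFirst : count q₀ m ≡ count (λ xs → z (0 ∷ xs) ∧ q₀ xs) m
      zeroFirst = count-cong m (λ xs _ → cong (_∧ q₀ xs) (sym (z[0∷xs]≡true xs)))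
      nonzeroFirst : ∑[ a < n ] count (z∧ (qₐ a)) m ≡
                     ∑[ a < n ] count (λ xs → z (suc (toℕ a) ∷ xs) ∧ qₐ a xs) m
      nonzeroFirst = sum-cong-≗ {n} (λ a →
        count-cong m (λ xs _ → cong (_∧ qₐ a xs) (sym (z-nonzero∷ a xs))))

module _ {n : ℕ} (p-prime : Prime (suc n)) where

  open Tuples n

  p∤product[] : does (suc n ∣? product []) ≡ false
  p∤product[] = dec-false (suc n ∣? 1) (λ p∣1 → ¬prime[1] (subst Prime (∣1⇒≡1 p∣1) p-prime))

  p∣product[0∷xs] : ∀ xs → does (suc n ∣? product (0 ∷ xs)) ≡ true
  p∣product[0∷xs] xs = dec-true (suc n ∣? 0) (suc n ∣0)

  p∣?product-nonzero∷ : ∀ (a : Fin n) xs →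
    does (suc n ∣? product (suc (toℕ a) ∷ xs)) ≡ does (suc n ∣? product xs)
  p∣?product-nonzero∷ a xs =
    does-⇔ (mk⇔ cancel (∣n⇒∣m*n (suc (toℕ a))))
           (suc n ∣? product (suc (toℕ a) ∷ xs)) (suc n ∣? product xs)
    where
    cancel : suc n ∣ suc (toℕ a) ℕ.* product xs → suc n ∣ product xs
    cancel p∣a*xs with euclidsLemma (suc (toℕ a)) (product xs) p-prime p∣a*xs
    ... | inj₁ p∣a  = contradiction (∣⇒≤ p∣a) (ℕP.<⇒≱ (s≤s (toℕ<n a)))
    ... | inj₂ p∣xs = p∣xs

  N[k∷J]≡count-countNonzero : ∀ k J → + N k (k ∷ J) (suc n) ≡
    count (esymsVanish (suc n) J) k - countNonzero (esymsVanish (suc n) J) k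
  N[k∷J]≡count-countNonzero k J = begin
      + N k (k ∷ J) (suc n)
    ≡⟨ N≡count k (k ∷ J) ⟩
      count (esymsVanish (suc n) (k ∷ J)) k
    ≡⟨ count-cong k (λ xs len≡k → cong (λ e → does (suc n ∣? e) ∧ q xs)
                                         (esym[k]≡product len≡k)) ⟩
      count (λ xs → divisible xs ∧ q xs) k
    ≡⟨ sym (subtract partition) ⟩
      count q k - countNonzero q k
    ∎
    where
    q divisible : List ℕ → Bool
    q = esymsVanish (suc n) J
    divisible xs = does (suc n ∣? product xs)
    esym[k]≡product : ∀ {xs} → length xs ≡ k → esym k xs ≡ product xs
    esym[k]≡product {xs} refl = esym[length]≡product xs
    partition : count q k ≡ count (λ xs → divisible xs ∧ q xs) k + countNonzero q k
    partition = count-partition divisible p∤product[] p∣product[0∷xs] p∣?product-nonzero∷ k q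
    subtract : ∀ {a b c} → a ≡ b + c → a - c ≡ b
    subtract {b = b} {c} refl = cancel b c
      where
      cancel : ∀ b c → b + c - c ≡ b
      cancel = solve-∀

mainTheorem6 : (k p : ℕ) → 2 ≤ k → Prime p → (J : List ℕ) →
    All (λ j → 1 ≤ j × j < k) J → J ≢ [] →
    + N k (k ∷ J) p ≡
      sumℤ (map (λ j → (ℤ.- ℤ.1ℤ) ℤ.^ suc j ℤ.* + (k C j)
                    ℤ.* + N (k ∸ j) (filter (λ x → x ≤? k ∸ j) J) p)
                 (map suc (upTo k)))
mainTheorem6 _ zero    _ p-prime _ _ _ = contradiction p-prime ¬prime[0]
mainTheorem6 k (suc n) _ p-prime J _ _ = begin
    + N k (k ∷ J) (suc n)
  ≡⟨ N[k∷J]≡count-countNonzero p-prime k J ⟩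
    f k - countNonzero q k
  ≡⟨ cong (_-_ (f k))
          (countNonzero≡iteratedDifference k (esymsVanish-zeroInsertionInvariant (suc n) J)) ⟩
    f k - iteratedDifference k f
  ≡⟨ last-minus-iteratedDifference k f ⟩
    ∑[ i < k ] (-1ℤ ^ suc (suc (toℕ i)) * + (k C suc (toℕ i)) * f (k ∸ suc (toℕ i)))
  ≡⟨ sum-cong-≗ {k} (λ i → cong (_*_ (-1ℤ ^ suc (suc (toℕ i)) * + (k C suc (toℕ i))))
                                 (sym (N[filter]≡count (k ∸ suc (toℕ i)) J))) ⟩
    ∑[ i < k ] term (suc (toℕ i))
  ≡⟨ sym (trans (cong (sumℤ ∘ map term) (map-upTo suc k)) (sumℤ-applyUpTo term suc k)) ⟩
    sumℤ (map term (map suc (upTo k)))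
  ∎
  where
  open Tuples n
  q : List ℕ → Bool
  q = esymsVanish (suc n) J
  f : ℕ → ℤ
  f = count q
  term : ℕ → ℤ
  term j = -1ℤ ^ suc j * + (k C j) * + N (k ∸ j) (filter (_≤? k ∸ j) J) (suc n)
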